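{- Let $\mathcal{L}$ be a family of linear laws involving a single binary operation symbol. Then the geometry monoid $G_{\mathcal{L}}$ does not contain the empty operator, and every element of $G_{\mathcal{L}}$ admits a seed $(l,r)$ in which $l$ and $r$ are injective terms.
   Context: Terms are built from an infinite set of variables using one binary operation symbol; addresses are words over $\{0,1\}$ and $t/\alpha$ is the subterm at $\alpha$. A term is injective if no variable occurs twice in it. A law $(l,r)$ is linear if $l$ and $r$ contain the same variables and both are injective. For a law $L=(l,r)$ and address $\alpha$, $O^{L,+}_\alpha$ is the partial operator replacing the subterm $t/\alpha=l\sigma$ ($\sigma$ a substitution) by $r\sigma$, and $O^{L,- }_\alpha$ is its inverse; $G_{\mathcal{L}}$ is the monoid of partial operators generated under composition by all $O^{L,\pm}_\alpha$, $L\in\mathcal{L}$. A pair of terms $(l,r)$ is a seed for a partial operator $f$ if $f$, as a set of pairs, consists exactly of all pairs $(l\sigma,r\sigma)$ with $\sigma$ a substitution. -}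

module Defs where

open import Data.Nat using (ℕ)
open import Data.Bool using (Bool; true; false)
open import Data.List using (List; []; _∷_; _++_)
open import Data.List.Membership.Propositional using (_∈_)
open import Data.List.Relation.Unary.Unique.Propositional using (Unique)
open import Data.Maybe using (Maybe; just; nothing)
open import Data.Product using (Σ; _×_; _,_; ∃)
open import Relation.Binary.PropositionalEquality using (_≡_)
open import Relation.Nullary using (¬_)
open import Function.Bundles using (_⇔_)

data Term : Set where
  var : ℕ → Term
  _·_ : Term → Term → Term

-- Addresses: words over {0,1}; false = 0 (left), true = 1 (right).
Address : Set
Address = List Bool

_/_ : Term → Address → Maybe Term
t / [] = just t
var x / (_ ∷ _) = nothing
(t₁ · t₂) / (false ∷ α) = t₁ / α
(t₁ · t₂) / (true ∷ α) = t₂ / α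

replace : Term → Address → Term → Maybe Term
replace t [] s = just s
replace (var x) (_ ∷ _) s = nothing
replace (t₁ · t₂) (false ∷ α) s with replace t₁ α s
... | just u = just (u · t₂)
... | nothing = nothing
replace (t₁ · t₂) (true ∷ α) s with replace t₂ α s
... | just u = just (t₁ · u)
... | nothing = nothing

vars : Term → List ℕ
vars (var x) = x ∷ []
vars (t₁ · t₂) = vars t₁ ++ vars t₂

Injective : Term → Set
Injective t = Unique (vars t)

Subst : Set
Subst = ℕ → Term

_[_] : Term → Subst → Term
var x [ σ ] = σ x
(t₁ · t₂) [ σ ] = (t₁ [ σ ]) · (t₂ [ σ ])

Law : Set
Law = Term × Term

Linear : Law → Set
Linear (l , r) = (∀ x → (x ∈ vars l) ⇔ (x ∈ vars r)) × Injective l × Injective r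

PartialOp : Set₁
PartialOp = Term → Term → Set

Op⁺ : Law → Address → PartialOp
Op⁺ (l , r) α t t' = Σ Subst λ σ → (t / α ≡ just (l [ σ ])) × (replace t α (r [ σ ]) ≡ just t')

Op⁻ : Law → Address → PartialOp
Op⁻ L α t t' = Op⁺ L α t' t

_∘ᵣ_ : PartialOp → PartialOp → PartialOp
(f ∘ᵣ g) t t'' = Σ Term λ t' → g t t' × f t' t''

idOp : PartialOp
idOp t t' = t ≡ t'

Family : Set₁
Family = Law → Set

record Generator (𝓛 : Family) : Set where
  constructor gen
  field
    law     : Law
    member  : 𝓛 law
    sign    : Bool     -- true = +, false = -
    address : Address

⟦_⟧g : {𝓛 : Family} → Generator 𝓛 → PartialOp
⟦ gen L _ true α ⟧g = Op⁺ L α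
⟦ gen L _ false α ⟧g = Op⁻ L α

-- elements of the geometry monoid G_𝓛: finite composites of generators
-- (the empty word denotes the identity operator)
⟦_⟧ : {𝓛 : Family} → List (Generator 𝓛) → PartialOp
⟦ [] ⟧ = idOp
⟦ g ∷ w ⟧ = ⟦ g ⟧g ∘ᵣ ⟦ w ⟧

InG : Family → PartialOp → Set
InG 𝓛 f = Σ (List (Generator 𝓛)) λ w → ∀ t t' → (f t t' ⇔ ⟦ w ⟧ t t')

EmptyOp : PartialOp → Set
EmptyOp f = ∀ t t' → ¬ f t t'

Seed : PartialOp → Term → Term → Set
Seed f l r = ∀ t t' → (f t t' ⇔ Σ Subst λ σ → (t ≡ l [ σ ]) × (t' ≡ r [ σ ]))

{-# OPTIONS --safe #-}
-- Call a seed (l, r) linear if l and r are injective with the same variables. The generator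
-- O^{L,+}_α has the linear seed (C[l], C[r]), where C is a context of fresh variables with its
-- hole at α, and O^{L,-}_α the swapped pair. Linear seeds are closed under composition: if (l₁, r₁)
-- seeds g and (l₂, r₂) seeds f, rename them apart and let θ be a most general unifier of r₁ and
-- l₂; then (l₁θ, r₂θ) seeds f ∘ g. Two variable-disjoint injective terms always unify, with an
-- injective common instance, and since l₁, r₁ (resp. l₂, r₂) have the same variables, l₁θ and
-- r₂θ are injective as well. An operator with seed (l, r) contains (l, r), so it is not empty.
module Submission where

open import Defs
open import Data.Bool using (true; false)
open import Data.Empty using (⊥)
open import Data.Nat using (ℕ; zero; suc; _≟_)
open import Data.Nat.Properties using (suc-injective)
open import Data.List using (List; []; _∷_; _++_; map; concatMap)
open import Data.List.Properties using (++-assoc; ++-identityʳ; map-++; concatMap-++)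
open import Data.List.Membership.Propositional using (_∈_; _∉_)
open import Data.List.Membership.Propositional.Properties using (∈-++⁺ˡ; ∈-++⁺ʳ; ∈-++⁻; ∈-map⁻)
open import Data.List.Membership.Propositional.Properties.WithK using (unique∧set⇒bag)
open import Data.List.Membership.DecPropositional _≟_ using (_∈?_)
open import Data.List.Relation.Unary.Any using (here; there)
import Data.List.Relation.Unary.All as All
open import Data.List.Relation.Unary.AllPairs using ([]; _∷_)
import Data.List.Relation.Unary.All.Properties as All
open import Data.List.Relation.Unary.Unique.Propositional using (Unique)
import Data.List.Relation.Unary.Unique.Propositional.Properties as Unique
open import Data.List.Relation.Binary.Disjoint.Propositional using (Disjoint)
open import Data.List.Relation.Binary.Subset.Propositional using (_⊆_)
import Data.List.Relation.Binary.Subset.Propositional.Properties as ⊆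
open import Data.List.Relation.Binary.Permutation.Propositional as Perm
  using (_↭_; ↭-sym; ↭⇒↭ₛ; module PermutationReasoning)
import Data.List.Relation.Binary.Permutation.Propositional.Properties as ↭
import Data.List.Relation.Binary.Permutation.Setoid.Properties as ↭ₛ
open import Data.List.Relation.Binary.BagAndSetEquality using (∼bag⇒↭)
open import Data.Maybe using (just)
open import Data.Product using (Σ; _×_; _,_)
open import Data.Sum using (inj₁; inj₂)
open import Function using (_∘_; const; flip)
open import Function.Bundles using (_⇔_; mk⇔; Equivalence)
open import Function.Construct.Composition using (_⇔-∘_)
open import Relation.Nullary using (¬_; yes; no; contradiction)
open import Relation.Binary.PropositionalEquality
  using (_≡_; _≢_; refl; sym; trans; cong; cong₂; subst; subst₂; setoid; module ≡-Reasoning)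

Unique-resp-↭ : ∀ {xs ys : List ℕ} → xs ↭ ys → Unique xs → Unique ys
Unique-resp-↭ xs↭ys = ↭ₛ.Unique-resp-↭ (setoid ℕ) (↭⇒↭ₛ xs↭ys)

Unique-++⁻ : ∀ (xs : List ℕ) {ys} → Unique (xs ++ ys) → Unique xs × Unique ys × Disjoint xs ys
Unique-++⁻ [] u = [] , u , λ { (() , _) }
Unique-++⁻ (x ∷ xs) (x∉xs++ys ∷ u) with Unique-++⁻ xs u | All.++⁻ xs x∉xs++ys
... | uxs , uys , disjoint | x∉xs , x∉ys = (x∉xs ∷ uxs) , uys , λ where
  (here refl , x∈ys) → All.lookup x∉ys x∈ys refl
  (there v∈xs , v∈ys) → disjoint (v∈xs , v∈ys)

concatMap-↭ : ∀ (f : ℕ → List ℕ) {xs ys} → xs ↭ ys → concatMap f xs ↭ concatMap f ys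
concatMap-↭ f Perm.refl = Perm.refl
concatMap-↭ f (Perm.prep x p) = ↭.++⁺ˡ (f x) (concatMap-↭ f p)
concatMap-↭ f (Perm.swap x y p) =
  Perm.trans (↭.shifts (f x) (f y)) (↭.++⁺ˡ (f y) (↭.++⁺ˡ (f x) (concatMap-↭ f p)))
concatMap-↭ f (Perm.trans p q) = Perm.trans (concatMap-↭ f p) (concatMap-↭ f q)

ren : (ℕ → ℕ) → Subst
ren ρ = var ∘ ρ

_⨾_ : Subst → Subst → Subst
(θ ⨾ ρ) x = θ x [ ρ ]

[]-cong : ∀ t {σ τ} → (∀ {x} → x ∈ vars t → σ x ≡ τ x) → t [ σ ] ≡ t [ τ ]
[]-cong (var x) σ≗τ = σ≗τ (here refl)
[]-cong (t₁ · t₂) σ≗τ =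
  cong₂ _·_ ([]-cong t₁ (σ≗τ ∘ ∈-++⁺ˡ)) ([]-cong t₂ (σ≗τ ∘ ∈-++⁺ʳ (vars t₁)))

[]-∘ : ∀ t θ ρ → t [ θ ] [ ρ ] ≡ t [ θ ⨾ ρ ]
[]-∘ (var x) θ ρ = refl
[]-∘ (t₁ · t₂) θ ρ = cong₂ _·_ ([]-∘ t₁ θ ρ) ([]-∘ t₂ θ ρ)

[]-identity : ∀ t → t [ var ] ≡ t
[]-identity (var x) = refl
[]-identity (t₁ · t₂) = cong₂ _·_ ([]-identity t₁) ([]-identity t₂)

[]-ren-∘ : ∀ t ρ′ θ ρ → t [ ren ρ′ ] [ θ ] [ ρ ] ≡ t [ (θ ⨾ ρ) ∘ ρ′ ]
[]-ren-∘ t ρ′ θ ρ = trans ([]-∘ (t [ ren ρ′ ]) θ ρ) ([]-∘ t (ren ρ′) (θ ⨾ ρ))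

vars-[] : ∀ t θ → vars (t [ θ ]) ≡ concatMap (vars ∘ θ) (vars t)
vars-[] (var x) θ = sym (++-identityʳ (vars (θ x)))
vars-[] (t₁ · t₂) θ =
  trans (cong₂ _++_ (vars-[] t₁ θ) (vars-[] t₂ θ))
        (sym (concatMap-++ (vars ∘ θ) (vars t₁) (vars t₂)))

vars-[]-↭ : ∀ s t θ → vars s ↭ vars t → vars (s [ θ ]) ↭ vars (t [ θ ])
vars-[]-↭ s t θ s↭t =
  subst₂ _↭_ (sym (vars-[] s θ)) (sym (vars-[] t θ)) (concatMap-↭ (vars ∘ θ) s↭t)

vars-ren : ∀ t ρ → vars (t [ ren ρ ]) ≡ map ρ (vars t)
vars-ren (var x) ρ = refl
vars-ren (t₁ · t₂) ρ =
  trans (cong₂ _++_ (vars-ren t₁ ρ) (vars-ren t₂ ρ)) (sym (map-++ ρ (vars t₁) (vars t₂)))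

Injective-ren : ∀ {ρ} → (∀ {x y} → ρ x ≡ ρ y → x ≡ y) → ∀ t → Injective t → Injective (t [ ren ρ ])
Injective-ren {ρ} ρ-injective t t-injective =
  subst Unique (sym (vars-ren t ρ)) (Unique.map⁺ ρ-injective t-injective)

even odd : ℕ → ℕ
even zero = zero
even (suc n) = suc (suc (even n))
odd n = suc (even n)

even-injective : ∀ {m n} → even m ≡ even n → m ≡ n
even-injective {zero} {zero} refl = refl
even-injective {suc m} {suc n} p = cong suc (even-injective (suc-injective (suc-injective p)))

odd-injective : ∀ {m n} → odd m ≡ odd n → m ≡ n
odd-injective = even-injective ∘ suc-injective

even≢odd : ∀ m n → even m ≢ odd n
even≢odd (suc m) (suc n) p = even≢odd m n (suc-injective (suc-injective p))

interleave : Subst → Subst → Subst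
interleave σ τ zero = σ zero
interleave σ τ (suc zero) = τ zero
interleave σ τ (suc (suc n)) = interleave (σ ∘ suc) (τ ∘ suc) n

interleave-even : ∀ σ τ n → interleave σ τ (even n) ≡ σ n
interleave-even σ τ zero = refl
interleave-even σ τ (suc n) = interleave-even (σ ∘ suc) (τ ∘ suc) n

interleave-odd : ∀ σ τ n → interleave σ τ (odd n) ≡ τ n
interleave-odd σ τ zero = refl
interleave-odd σ τ (suc n) = interleave-odd (σ ∘ suc) (τ ∘ suc) n

[]-interleave-even : ∀ t σ τ → t [ ren even ] [ interleave σ τ ] ≡ t [ σ ]
[]-interleave-even t σ τ = trans ([]-∘ t (ren even) _) ([]-cong t (λ _ → interleave-even σ τ _))

[]-interleave-odd : ∀ t σ τ → t [ ren odd ] [ interleave σ τ ] ≡ t [ τ ]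
[]-interleave-odd t σ τ = trans ([]-∘ t (ren odd) _) ([]-cong t (λ _ → interleave-odd σ τ _))

vars-even-odd-disjoint : ∀ s t → Disjoint (vars (s [ ren even ])) (vars (t [ ren odd ]))
vars-even-odd-disjoint s t (v∈s , v∈t)
  with m , _ , refl ← ∈-map⁻ even (subst (_ ∈_) (vars-ren s even) v∈s)
     | n , _ , v≡odd ← ∈-map⁻ odd (subst (_ ∈_) (vars-ren t odd) v∈t)
  = even≢odd m n v≡odd

_on_else_ : Subst → List ℕ → Subst → Subst
(θ₁ on A else θ₂) x with x ∈? A
... | yes _ = θ₁ x
... | no _ = θ₂ x

on-else-∈ : ∀ θ₁ θ₂ {A x} → x ∈ A → (θ₁ on A else θ₂) x ≡ θ₁ x
on-else-∈ θ₁ θ₂ {A} {x} x∈A with x ∈? A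
... | yes _ = refl
... | no x∉A = contradiction x∈A x∉A

on-else-∉ : ∀ θ₁ θ₂ {A x} → x ∉ A → (θ₁ on A else θ₂) x ≡ θ₂ x
on-else-∉ θ₁ θ₂ {A} {x} x∉A with x ∈? A
... | yes x∈A = contradiction x∈A x∉A
... | no _ = refl

·-injective : ∀ {s₁ s₂ u₁ u₂} → s₁ · s₂ ≡ u₁ · u₂ → s₁ ≡ u₁ × s₂ ≡ u₂
·-injective refl = refl , refl

record Unifier (s u : Term) : Set where
  field
    θ            : Subst
    unifies      : s [ θ ] ≡ u [ θ ]
    injective    : Injective (s [ θ ])
    vars-⊆       : vars (s [ θ ]) ⊆ vars (s · u)
    -- θ is idempotent, so every unifier σ factors as θ ⨾ σ.
    most-general : ∀ σ → s [ σ ] ≡ u [ σ ] → ∀ {x} → x ∈ vars (s · u) → σ x ≡ θ x [ σ ]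

  unifies-≗ : ∀ {θ′} → (∀ {x} → x ∈ vars (s · u) → θ′ x ≡ θ x) → s [ θ′ ] ≡ u [ θ′ ]
  unifies-≗ {θ′} θ′≗θ = begin
    s [ θ′ ] ≡⟨ []-cong s (θ′≗θ ∘ ∈-++⁺ˡ) ⟩
    s [ θ ]  ≡⟨ unifies ⟩
    u [ θ ]  ≡⟨ []-cong u (λ x∈u → sym (θ′≗θ (∈-++⁺ʳ (vars s) x∈u))) ⟩
    u [ θ′ ] ∎
    where open ≡-Reasoning

  []-factors : ∀ σ → s [ σ ] ≡ u [ σ ] → ∀ t → vars t ⊆ vars (s · u) → t [ σ ] ≡ t [ θ ] [ σ ]
  []-factors σ σ-unifies t t⊆ =
    trans ([]-cong t (most-general σ σ-unifies ∘ t⊆)) (sym ([]-∘ t θ σ))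

Unifier-sym : ∀ {s u} → Unifier s u → Unifier u s
Unifier-sym {s} {u} U = record
  { θ = θ
  ; unifies = sym unifies
  ; injective = subst Injective unifies injective
  ; vars-⊆ = ∈-resp-++-comm (vars s) ∘ vars-⊆ ∘ subst (λ t → _ ∈ vars t) (sym unifies)
  ; most-general = λ σ σ-unifies → most-general σ (sym σ-unifies) ∘ ∈-resp-++-comm (vars u)
  }
  where
  open Unifier U
  ∈-resp-++-comm : ∀ xs {ys x} → x ∈ xs ++ ys → x ∈ ys ++ xs
  ∈-resp-++-comm xs {ys} = ↭.∈-resp-↭ (↭.++-comm xs ys)

unify-var : ∀ {x u} → Injective (var x · u) → Unifier (var x) u
unify-var {x} {u} (x∉u ∷ u-injective) = record
  { θ = bind
  ; unifies = trans bind-x (sym u[bind]≡u)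
  ; injective = subst Injective (sym bind-x) u-injective
  ; vars-⊆ = there ∘ subst (λ t → _ ∈ vars t) bind-x
  ; most-general = λ where
      σ σx≡uσ (here refl) → trans σx≡uσ (cong (_[ σ ]) (sym bind-x))
      σ _ (there y∈u) → cong (_[ σ ]) (sym (bind-other y∈u))
  }
  where
  bind : Subst
  bind = const u on x ∷ [] else var
  bind-x : bind x ≡ u
  bind-x = on-else-∈ (const u) var {x = x} (here refl)
  bind-other : ∀ {y} → y ∈ vars u → bind y ≡ var y
  bind-other y∈u = on-else-∉ (const u) var {x ∷ []} λ { (here refl) → All.lookup x∉u y∈u refl }
  u[bind]≡u : u [ bind ] ≡ u
  u[bind]≡u = trans ([]-cong u bind-other) ([]-identity u)

vars-interchange : ∀ a b c d → vars ((a · b) · (c · d)) ↭ vars ((a · c) · (b · d))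
vars-interchange a b c d = begin
  (va ++ vb) ++ (vc ++ vd) ≡⟨ ++-assoc va vb _ ⟩
  va ++ vb ++ vc ++ vd     ↭⟨ ↭.++⁺ˡ va (↭.shifts vb vc) ⟩
  va ++ vc ++ vb ++ vd     ≡⟨ sym (++-assoc va vc _) ⟩
  (va ++ vc) ++ vb ++ vd   ∎
  where
  open PermutationReasoning
  va = vars a
  vb = vars b
  vc = vars c
  vd = vars d

unify-· : ∀ {s₁ s₂ u₁ u₂} → Unifier s₁ u₁ → Unifier s₂ u₂ →
          Disjoint (vars (s₁ · u₁)) (vars (s₂ · u₂)) → Unifier (s₁ · s₂) (u₁ · u₂)
unify-· {s₁} {s₂} {u₁} {u₂} U₁ U₂ disjoint = record
  { θ = θ
  ; unifies = cong₂ _·_ (U₁.unifies-≗ θ≗θ₁) (U₂.unifies-≗ θ≗θ₂)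
  ; injective = subst Injective (sym sθ≡) (Unique.++⁺ U₁.injective U₂.injective
      λ (v∈₁ , v∈₂) → disjoint (U₁.vars-⊆ v∈₁ , U₂.vars-⊆ v∈₂))
  ; vars-⊆ = λ {v} v∈ → ↭.∈-resp-↭ (↭-sym (vars-interchange s₁ s₂ u₁ u₂))
      (⊆.++⁺ U₁.vars-⊆ U₂.vars-⊆ (subst (λ t → v ∈ vars t) sθ≡ v∈))
  ; most-general = most-general
  }
  where
  module U₁ = Unifier U₁
  module U₂ = Unifier U₂
  θ : Subst
  θ = U₁.θ on vars (s₁ · u₁) else U₂.θ
  θ≗θ₁ : ∀ {x} → x ∈ vars (s₁ · u₁) → θ x ≡ U₁.θ x
  θ≗θ₁ = on-else-∈ U₁.θ U₂.θ
  θ≗θ₂ : ∀ {x} → x ∈ vars (s₂ · u₂) → θ x ≡ U₂.θ x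
  θ≗θ₂ x∈₂ = on-else-∉ U₁.θ U₂.θ {vars (s₁ · u₁)} λ x∈₁ → disjoint (x∈₁ , x∈₂)
  sθ≡ : (s₁ · s₂) [ θ ] ≡ (s₁ [ U₁.θ ]) · (s₂ [ U₂.θ ])
  sθ≡ = cong₂ _·_ ([]-cong s₁ (θ≗θ₁ ∘ ∈-++⁺ˡ)) ([]-cong s₂ (θ≗θ₂ ∘ ∈-++⁺ˡ))
  most-general : ∀ σ → (s₁ · s₂) [ σ ] ≡ (u₁ · u₂) [ σ ] →
                 ∀ {x} → x ∈ vars ((s₁ · s₂) · (u₁ · u₂)) → σ x ≡ θ x [ σ ]
  most-general σ σ-unifies x∈ with σ-unifies₁ , σ-unifies₂ ← ·-injective σ-unifies
    with ∈-++⁻ (vars (s₁ · u₁)) (↭.∈-resp-↭ (vars-interchange s₁ s₂ u₁ u₂) x∈)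
  ... | inj₁ x∈₁ = trans (U₁.most-general σ σ-unifies₁ x∈₁) (cong (_[ σ ]) (sym (θ≗θ₁ x∈₁)))
  ... | inj₂ x∈₂ = trans (U₂.most-general σ σ-unifies₂ x∈₂) (cong (_[ σ ]) (sym (θ≗θ₂ x∈₂)))

unify : ∀ s u → Injective (s · u) → Unifier s u
unify (var x) u injective = unify-var injective
unify (s₁ · s₂) (var y) injective =
  Unifier-sym (unify-var (Unique-resp-↭ (↭.++-comm (vars (s₁ · s₂)) (y ∷ [])) injective))
unify (s₁ · s₂) (u₁ · u₂) injective
  with injective₁ , injective₂ , disjoint ←
         Unique-++⁻ (vars (s₁ · u₁)) (Unique-resp-↭ (vars-interchange s₁ s₂ u₁ u₂) injective)
  = unify-· (unify s₁ u₁ injective₁) (unify s₂ u₂ injective₂) disjoint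

-- For injective sides, `vars lhs ↭ vars rhs` says that both sides have the same variables.
record LinearSeed (f : PartialOp) : Set where
  field
    lhs rhs       : Term
    lhs-injective : Injective lhs
    vars-↭        : vars lhs ↭ vars rhs
    seed          : Seed f lhs rhs

  rhs-injective : Injective rhs
  rhs-injective = Unique-resp-↭ vars-↭ lhs-injective

  match : ∀ {t t′} → f t t′ → Σ Subst λ σ → t ≡ lhs [ σ ] × t′ ≡ rhs [ σ ]
  match = Equivalence.to (seed _ _)

  instantiate : ∀ σ {t t′} → t ≡ lhs [ σ ] → t′ ≡ rhs [ σ ] → f t t′
  instantiate σ t≡ t′≡ = Equivalence.from (seed _ _) (σ , t≡ , t′≡)

open LinearSeed

linearSeed-resp-⇔ : ∀ {f g} → (∀ t t′ → f t t′ ⇔ g t t′) → LinearSeed g → LinearSeed f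
linearSeed-resp-⇔ f⇔g G = record
  { lhs = lhs G ; rhs = rhs G ; lhs-injective = lhs-injective G ; vars-↭ = vars-↭ G
  ; seed = λ t t′ → seed G t t′ ⇔-∘ f⇔g t t′
  }

linearSeed-idOp : LinearSeed idOp
linearSeed-idOp = record
  { lhs = var 0 ; rhs = var 0 ; lhs-injective = All.[] ∷ [] ; vars-↭ = Perm.refl
  ; seed = λ t t′ → mk⇔ (λ { refl → const t , refl , refl }) (λ { (σ , refl , refl) → refl })
  }

linearSeed-flip : ∀ {f} → LinearSeed f → LinearSeed (flip f)
linearSeed-flip F = record
  { lhs = rhs F ; rhs = lhs F ; lhs-injective = rhs-injective F ; vars-↭ = ↭-sym (vars-↭ F)
  ; seed = λ t t′ → mk⇔ (λ p → let σ , t′≡ , t≡ = match F p in σ , t≡ , t′≡)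
                        (λ (σ , t≡ , t′≡) → instantiate F σ t′≡ t≡)
  }

_⊗_ : PartialOp → PartialOp → PartialOp
(f ⊗ g) (t₁ · t₂) (u₁ · u₂) = f t₁ u₁ × g t₂ u₂
(f ⊗ g) _ _ = ⊥

linearSeed-⊗ : ∀ {f g} → LinearSeed f → LinearSeed g → LinearSeed (f ⊗ g)
linearSeed-⊗ {f} {g} F G = record
  { lhs = a′ · b′
  ; rhs = c′ · d′
  ; lhs-injective = Unique.++⁺ (Injective-ren even-injective (lhs F) (lhs-injective F))
                               (Injective-ren odd-injective (lhs G) (lhs-injective G))
                               (vars-even-odd-disjoint (lhs F) (lhs G))
  ; vars-↭ = ↭.++⁺ (vars-[]-↭ (lhs F) (rhs F) (ren even) (vars-↭ F))
                   (vars-[]-↭ (lhs G) (rhs G) (ren odd) (vars-↭ G))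
  ; seed = λ t t′ → mk⇔ to from
  }
  where
  a′ = lhs F [ ren even ]
  c′ = rhs F [ ren even ]
  b′ = lhs G [ ren odd ]
  d′ = rhs G [ ren odd ]
  to : ∀ {t t′} → (f ⊗ g) t t′ → Σ Subst λ σ → t ≡ (a′ · b′) [ σ ] × t′ ≡ (c′ · d′) [ σ ]
  to {_ · _} {_ · _} (p , q) with σ₁ , refl , refl ← match F p | σ₂ , refl , refl ← match G q =
    interleave σ₁ σ₂ ,
    sym (cong₂ _·_ ([]-interleave-even (lhs F) σ₁ σ₂) ([]-interleave-odd (lhs G) σ₁ σ₂)) ,
    sym (cong₂ _·_ ([]-interleave-even (rhs F) σ₁ σ₂) ([]-interleave-odd (rhs G) σ₁ σ₂))
  from : ∀ {t t′} → (Σ Subst λ σ → t ≡ (a′ · b′) [ σ ] × t′ ≡ (c′ · d′) [ σ ]) → (f ⊗ g) t t′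
  from (σ , refl , refl) =
    instantiate F (σ ∘ even) ([]-∘ (lhs F) (ren even) σ) ([]-∘ (rhs F) (ren even) σ) ,
    instantiate G (σ ∘ odd) ([]-∘ (lhs G) (ren odd) σ) ([]-∘ (rhs G) (ren odd) σ)

linearSeed-∘ᵣ : ∀ {f g} → LinearSeed f → LinearSeed g → LinearSeed (f ∘ᵣ g)
linearSeed-∘ᵣ {f} {g} F G = record
  { lhs = l₁′ [ θ ]
  ; rhs = r₂′ [ θ ]
  ; lhs-injective = Unique-resp-↭ (↭-sym (vars-[]-↭ l₁′ r₁′ θ l₁′↭r₁′)) injective
  ; vars-↭ = begin
      vars (l₁′ [ θ ]) ↭⟨ vars-[]-↭ l₁′ r₁′ θ l₁′↭r₁′ ⟩
      vars (r₁′ [ θ ]) ≡⟨ cong vars unifies ⟩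
      vars (l₂′ [ θ ]) ↭⟨ vars-[]-↭ l₂′ r₂′ θ l₂′↭r₂′ ⟩
      vars (r₂′ [ θ ]) ∎
  ; seed = λ t t′ → mk⇔ to from
  }
  where
  open PermutationReasoning
  l₁′ = lhs G [ ren even ]
  r₁′ = rhs G [ ren even ]
  l₂′ = lhs F [ ren odd ]
  r₂′ = rhs F [ ren odd ]
  l₁′↭r₁′ : vars l₁′ ↭ vars r₁′
  l₁′↭r₁′ = vars-[]-↭ (lhs G) (rhs G) (ren even) (vars-↭ G)
  l₂′↭r₂′ : vars l₂′ ↭ vars r₂′
  l₂′↭r₂′ = vars-[]-↭ (lhs F) (rhs F) (ren odd) (vars-↭ F)
  U : Unifier r₁′ l₂′
  U = unify r₁′ l₂′ (Unique.++⁺ (Injective-ren even-injective (rhs G) (rhs-injective G))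
                                (Injective-ren odd-injective (lhs F) (lhs-injective F))
                                (vars-even-odd-disjoint (rhs G) (lhs F)))
  open Unifier U
  to : ∀ {t t″} → (f ∘ᵣ g) t t″ → Σ Subst λ σ → t ≡ l₁′ [ θ ] [ σ ] × t″ ≡ r₂′ [ θ ] [ σ ]
  to (t′ , p , q) with σ₁ , refl , refl ← match G p | σ₂ , t′≡ , refl ← match F q =
    σ ,
    trans (sym ([]-interleave-even (lhs G) σ₁ σ₂))
          ([]-factors σ σ-unifies l₁′ (∈-++⁺ˡ ∘ ↭.∈-resp-↭ l₁′↭r₁′)) ,
    trans (sym ([]-interleave-odd (rhs F) σ₁ σ₂))
          ([]-factors σ σ-unifies r₂′ (∈-++⁺ʳ (vars r₁′) ∘ ↭.∈-resp-↭ (↭-sym l₂′↭r₂′)))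
    where
    σ = interleave σ₁ σ₂
    σ-unifies : r₁′ [ σ ] ≡ l₂′ [ σ ]
    σ-unifies = trans ([]-interleave-even (rhs G) σ₁ σ₂)
                      (trans t′≡ (sym ([]-interleave-odd (lhs F) σ₁ σ₂)))
  from : ∀ {t t″} → (Σ Subst λ ρ → t ≡ l₁′ [ θ ] [ ρ ] × t″ ≡ r₂′ [ θ ] [ ρ ]) → (f ∘ᵣ g) t t″
  from (ρ , refl , refl) =
    r₁′ [ θ ] [ ρ ] ,
    instantiate G ((θ ⨾ ρ) ∘ even) ([]-ren-∘ (lhs G) even θ ρ) ([]-ren-∘ (rhs G) even θ ρ) ,
    instantiate F ((θ ⨾ ρ) ∘ odd) (trans (cong (_[ ρ ]) unifies) ([]-ren-∘ (lhs F) odd θ ρ))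
                                  ([]-ren-∘ (rhs F) odd θ ρ)

replace-left : ∀ t₁ t₂ α {s u} →
               replace t₁ α s ≡ just u → replace (t₁ · t₂) (false ∷ α) s ≡ just (u · t₂)
replace-left _ _ _ eq rewrite eq = refl

replace-right : ∀ t₁ t₂ α {s u} →
                replace t₂ α s ≡ just u → replace (t₁ · t₂) (true ∷ α) s ≡ just (t₁ · u)
replace-right _ _ _ eq rewrite eq = refl

Op⁺-left : ∀ l r α t t′ → Op⁺ (l , r) (false ∷ α) t t′ ⇔ (Op⁺ (l , r) α ⊗ idOp) t t′
Op⁺-left l r α _ _ = mk⇔ to from
  where
  to : ∀ {t t′} → Op⁺ (l , r) (false ∷ α) t t′ → (Op⁺ (l , r) α ⊗ idOp) t t′
  to {t₁ · t₂} (σ , matches , replaced) with replace t₁ α (r [ σ ]) in eq | replaced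
  ... | just u | refl = (σ , matches , eq) , refl
  from : ∀ {t t′} → (Op⁺ (l , r) α ⊗ idOp) t t′ → Op⁺ (l , r) (false ∷ α) t t′
  from {t₁ · t₂} {_ · _} ((σ , matches , replaced) , refl) =
    σ , matches , replace-left t₁ t₂ α replaced

Op⁺-right : ∀ l r α t t′ → Op⁺ (l , r) (true ∷ α) t t′ ⇔ (idOp ⊗ Op⁺ (l , r) α) t t′
Op⁺-right l r α _ _ = mk⇔ to from
  where
  to : ∀ {t t′} → Op⁺ (l , r) (true ∷ α) t t′ → (idOp ⊗ Op⁺ (l , r) α) t t′
  to {t₁ · t₂} (σ , matches , replaced) with replace t₂ α (r [ σ ]) in eq | replaced
  ... | just u | refl = refl , (σ , matches , eq)
  from : ∀ {t t′} → (idOp ⊗ Op⁺ (l , r) α) t t′ → Op⁺ (l , r) (true ∷ α) t t′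
  from {t₁ · t₂} {_ · _} (refl , (σ , matches , replaced)) =
    σ , matches , replace-right t₁ t₂ α replaced

linearSeed-Op⁺ : ∀ L → Linear L → ∀ α → LinearSeed (Op⁺ L α)
linearSeed-Op⁺ (l , r) (same-vars , l-injective , r-injective) [] = record
  { lhs = l ; rhs = r ; lhs-injective = l-injective
  ; vars-↭ = ∼bag⇒↭ (unique∧set⇒bag l-injective r-injective (same-vars _))
  ; seed = λ t t′ → mk⇔ (λ { (σ , refl , refl) → σ , refl , refl })
                        (λ { (σ , refl , refl) → σ , refl , refl })
  }
linearSeed-Op⁺ (l , r) linear (false ∷ α) =
  linearSeed-resp-⇔ (Op⁺-left l r α)
    (linearSeed-⊗ (linearSeed-Op⁺ (l , r) linear α) linearSeed-idOp)
linearSeed-Op⁺ (l , r) linear (true ∷ α) =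
  linearSeed-resp-⇔ (Op⁺-right l r α)
    (linearSeed-⊗ linearSeed-idOp (linearSeed-Op⁺ (l , r) linear α))

linearSeed-⟦⟧ : ∀ {𝓛} → (∀ L → 𝓛 L → Linear L) → ∀ w → LinearSeed (⟦_⟧ {𝓛} w)
linearSeed-⟦⟧ linear [] = linearSeed-idOp
linearSeed-⟦⟧ linear (gen L L∈𝓛 true α ∷ w) =
  linearSeed-∘ᵣ (linearSeed-Op⁺ L (linear L L∈𝓛) α) (linearSeed-⟦⟧ linear w)
linearSeed-⟦⟧ linear (gen L L∈𝓛 false α ∷ w) =
  linearSeed-∘ᵣ (linearSeed-flip (linearSeed-Op⁺ L (linear L L∈𝓛) α)) (linearSeed-⟦⟧ linear w)

linearSeed⇒¬EmptyOp : ∀ {f} → LinearSeed f → ¬ EmptyOp f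
linearSeed⇒¬EmptyOp F empty = empty _ _ (instantiate F var refl refl)

lemma2p5 : (𝓛 : Family) → (∀ L → 𝓛 L → Linear L) →
    (f : PartialOp) → InG 𝓛 f →
      ¬ EmptyOp f × Σ Term (λ l → Σ Term (λ r → Injective l × Injective r × Seed f l r))
lemma2p5 𝓛 linear f (w , f⇔⟦w⟧) =
  linearSeed⇒¬EmptyOp F , lhs F , rhs F , lhs-injective F , rhs-injective F , seed F
  where
  F : LinearSeed f
  F = linearSeed-resp-⇔ f⇔⟦w⟧ (linearSeed-⟦⟧ linear w)
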